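{- Let $K_n^*$ be the complete digraph of order $n\geq 3$. Then $b_I(K_n^*)=n$.
   Context: $K_n^*$ is the digraph on $n$ vertices with both arcs $uv$ and $vu$ for every pair of distinct vertices $u,v$ (the associated digraph of the complete graph $K_n$). An Italian dominating function (IDF) on a digraph $D$ is a function $f:V(D)\to\{0,1,2\}$ such that every vertex $v$ with $f(v)=0$ has at least two in-neighbors $w$ with $f(w)=1$ or at least one in-neighbor $w$ with $f(w)=2$; its weight is $\sum_u f(u)$ and $\gamma_I(D)$ is the minimum weight of an IDF. The Italian bondage number $b_I(D)$ is the minimum number of arcs of $A(D)$ whose removal from $D$ (keeping all vertices) results in a digraph $D'$ with $\gamma_I(D')>\gamma_I(D)$. -}

module Defs where

open import Data.Nat using (ℕ; _<_; _≤_)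
open import Data.Fin using (Fin; toℕ)
open import Data.List using (List; map; allFin; length)
open import Data.Nat.ListAction using (sum)
open import Data.List.Relation.Unary.All using (All)
open import Data.List.Relation.Unary.Unique.Propositional using (Unique)
open import Data.List.Membership.Propositional using (_∈_; _∉_)
open import Data.Product using (Σ; _×_; _,_; ∃)
open import Data.Sum using (_⊎_)
open import Relation.Binary.PropositionalEquality using (_≡_; _≢_)

-- A digraph on vertex set Fin n, given by its arc relation (Arc u v = "uv is an arc").
Digraph : ℕ → Set₁
Digraph n = Fin n → Fin n → Set

K* : (n : ℕ) → Digraph n
K* n u v = u ≢ v

ArcSet : {n : ℕ} → Digraph n → List (Fin n × Fin n) → Set
ArcSet D S = Unique S × All (λ { (u , v) → D u v }) S

removeArcs : {n : ℕ} → Digraph n → List (Fin n × Fin n) → Digraph n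
removeArcs D S u v = D u v × ((u , v) ∉ S)

Labeling : ℕ → Set
Labeling n = Fin n → Fin 3

weight : {n : ℕ} → Labeling n → ℕ
weight {n} f = sum (map (λ v → toℕ (f v)) (allFin n))

IsIDF : {n : ℕ} → Digraph n → Labeling n → Set
IsIDF {n} D f = (v : Fin n) → toℕ (f v) ≡ 0 →
    (Σ (Fin n) λ u → Σ (Fin n) λ w →
        u ≢ w × D u v × D w v × toℕ (f u) ≡ 1 × toℕ (f w) ≡ 1)
  ⊎ (Σ (Fin n) λ w → D w v × toℕ (f w) ≡ 2)

IsItalianDominationNumber : {n : ℕ} → Digraph n → ℕ → Set
IsItalianDominationNumber {n} D k =
  (Σ (Labeling n) λ f → IsIDF D f × weight f ≡ k)
  × ((f : Labeling n) → IsIDF D f → k ≤ weight f)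

GammaIIncreases : {n : ℕ} → Digraph n → Digraph n → Set
GammaIIncreases {n} D D' =
  Σ ℕ λ k → IsItalianDominationNumber D k ×
    ((f : Labeling n) → IsIDF D' f → k < weight f)

IsItalianBondageNumber : {n : ℕ} → Digraph n → ℕ → Set
IsItalianBondageNumber {n} D m =
  (Σ (List (Fin n × Fin n)) λ S →
      ArcSet D S × length S ≡ m × GammaIIncreases D (removeArcs D S))
  × ((S : List (Fin n × Fin n)) → ArcSet D S →
      GammaIIncreases D (removeArcs D S) → m ≤ length S)

-- An Italian dominating function of any digraph on at least two vertices has weight at least 2,
-- and in K_n^* a single vertex labelled 2 dominates everything, so γ_I(K_n^*) = 2. Removing
-- fewer than n arcs leaves some vertex v with all its out-arcs, and the labelling 2 at v
-- still dominates: b_I ≥ n. Conversely, remove one out-arc u → σ u from every vertex, for a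
-- map σ without fixed points or 2-cycles. A vertex v labelled 2 no longer dominates σ v, and
-- if only two vertices u, w are labelled 1 then σ u or σ w is labelled 0 and undominated, so
-- every IDF of the remaining digraph has weight at least 3: b_I ≤ n.
module Submission where

open import Defs
open import Data.Nat using (ℕ; zero; suc; _+_; _≤_; _<_; z≤n; s≤s; _≤?_) renaming (_≟_ to _≟ℕ_)
open import Data.Nat.Properties
  using (≤-trans; ≤-reflexive; +-mono-≤; +-monoʳ-≤; m≤m+n; +-identityʳ; +-assoc; 1+n≢0; ≰⇒>; <⇒≱;
         n<1⇒n≡0; n≢0⇒n>0; n≤1+n; +-0-commutativeMonoid)
open import Data.Fin using (Fin; toℕ; punchIn; punchOut; zero; suc)
open import Data.Fin.Properties
  using (_≟_; all?; ¬∀⟶∃¬; pigeonhole; <⇒≢; punchIn-punchOut; punchOut-injective; punchInᵢ≢i)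
open import Data.List using (List; map; allFin; length; tabulate; lookup)
open import Data.List.Properties using (map-tabulate; length-map; length-tabulate)
open import Data.Nat.ListAction using (sum)
open import Data.List.Relation.Unary.Any using (index; any?)
open import Data.List.Relation.Unary.Any.Properties using (lookup-index)
open import Data.List.Relation.Unary.All.Properties using (tabulate⁺) renaming (map⁺ to All-map⁺)
open import Data.List.Relation.Unary.Unique.Propositional.Properties using (allFin⁺)
  renaming (map⁺ to Unique-map⁺)
open import Data.List.Membership.Propositional using (_∈_; _∉_)
open import Data.List.Membership.Propositional.Properties using (∈-map⁺; ∈-allFin)
open import Data.Product using (_×_; _,_; ∃; ∃₂; proj₁)
open import Data.Sum using (_⊎_; inj₁; inj₂)
open import Function using (_∘_)
open import Relation.Nullary using (¬_; yes; no; contradiction)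
open import Relation.Binary.PropositionalEquality
open import Algebra.Properties.CommutativeMonoid.Sum +-0-commutativeMonoid
  using (sum-remove; sum-cong-≗; sum-replicate-zero) renaming (sum to ∑)

weight≡∑ : ∀ {n} (f : Labeling n) → weight f ≡ ∑ (toℕ ∘ f)
weight≡∑ f = trans (cong sum (map-tabulate (λ v → v) (toℕ ∘ f))) (sum-tabulate (toℕ ∘ f))
  where
  sum-tabulate : ∀ {m} (g : Fin m → ℕ) → sum (tabulate g) ≡ ∑ g
  sum-tabulate {zero} g = refl
  sum-tabulate {suc m} g = cong (g zero +_) (sum-tabulate (g ∘ suc))

≤∑ : ∀ {n} (g : Fin n → ℕ) i → g i ≤ ∑ g
≤∑ {suc _} g i = ≤-trans (m≤m+n (g i) _) (≤-reflexive (sym (sum-remove {i = i} g)))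

+≤∑ : ∀ {n} (g : Fin n → ℕ) {i j} → i ≢ j → g i + g j ≤ ∑ g
+≤∑ {suc _} g {i} {j} i≢j = ≤-trans (+-monoʳ-≤ (g i) gj≤rest) (≤-reflexive (sym (sum-remove {i = i} g)))
  where
  gj≤rest : g j ≤ ∑ (g ∘ punchIn i)
  gj≤rest = subst (_≤ ∑ (g ∘ punchIn i)) (cong g (punchIn-punchOut i≢j)) (≤∑ (g ∘ punchIn i) (punchOut i≢j))

++≤∑ : ∀ {n} (g : Fin n → ℕ) {i j k} → i ≢ j → i ≢ k → j ≢ k → g i + g j + g k ≤ ∑ g
++≤∑ {suc _} g {i} {j} {k} i≢j i≢k j≢k = begin
  g i + g j + g k                 ≡⟨ +-assoc (g i) (g j) (g k) ⟩
  g i + (g j + g k)               ≤⟨ +-monoʳ-≤ (g i) gj+gk≤rest ⟩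
  g i + ∑ (g ∘ punchIn i)         ≡⟨ sym (sum-remove {i = i} g) ⟩
  ∑ g                             ∎
  where
  open Data.Nat.Properties.≤-Reasoning
  gj+gk≤rest : g j + g k ≤ ∑ (g ∘ punchIn i)
  gj+gk≤rest = subst₂ (λ a b → a + b ≤ ∑ (g ∘ punchIn i))
    (cong g (punchIn-punchOut i≢j)) (cong g (punchIn-punchOut i≢k))
    (+≤∑ (g ∘ punchIn i) (j≢k ∘ punchOut-injective i≢j i≢k))

length≤∑ : ∀ {n} (g : Fin n → ℕ) → (∀ i → 1 ≤ g i) → n ≤ ∑ g
length≤∑ {zero} g pos = z≤n
length≤∑ {suc n} g pos = +-mono-≤ (pos zero) (length≤∑ (g ∘ suc) (pos ∘ suc))

∑-single : ∀ {n} (g : Fin n → ℕ) i → (∀ j → j ≢ i → g j ≡ 0) → ∑ g ≡ g i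
∑-single {suc n} g i zero-elsewhere = begin
  ∑ g                         ≡⟨ sum-remove {i = i} g ⟩
  g i + ∑ (g ∘ punchIn i)     ≡⟨ cong (g i +_) (sum-cong-≗ (λ j → zero-elsewhere _ (punchInᵢ≢i i j))) ⟩
  g i + ∑ {n} (λ _ → 0)       ≡⟨ cong (g i +_) (sum-replicate-zero n) ⟩
  g i + 0                     ≡⟨ +-identityʳ (g i) ⟩
  g i                         ∎
  where open ≡-Reasoning

twoAt : ∀ {n} → Fin n → Labeling n
twoAt v x with x ≟ v
... | yes _ = suc (suc zero)
... | no _ = zero

twoAt-here : ∀ {n} (v : Fin n) → toℕ (twoAt v v) ≡ 2
twoAt-here v with v ≟ v
... | yes _ = refl
... | no v≢v = contradiction refl v≢v

twoAt-elsewhere : ∀ {n} (v x : Fin n) → x ≢ v → toℕ (twoAt v x) ≡ 0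
twoAt-elsewhere v x x≢v with x ≟ v
... | yes x≡v = contradiction x≡v x≢v
... | no _ = refl

weight-twoAt : ∀ {n} (v : Fin n) → weight (twoAt v) ≡ 2
weight-twoAt v = begin
  weight (twoAt v)         ≡⟨ weight≡∑ (twoAt v) ⟩
  ∑ (toℕ ∘ twoAt v)        ≡⟨ ∑-single (toℕ ∘ twoAt v) v (twoAt-elsewhere v) ⟩
  toℕ (twoAt v v)          ≡⟨ twoAt-here v ⟩
  2                        ∎
  where open ≡-Reasoning

twoAt-IDF : ∀ {n} {D : Digraph n} (v : Fin n) → (∀ x → x ≢ v → D v x) → IsIDF D (twoAt v)
twoAt-IDF v out x twoAt-x≡0 with x ≟ v
... | yes _ = contradiction twoAt-x≡0 1+n≢0
... | no x≢v = inj₂ (v , out x x≢v , twoAt-here v)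

IDF-cases : ∀ {n} {D : Digraph n} {f : Labeling n} → IsIDF D f →
    (∃ λ v → toℕ (f v) ≡ 2)
  ⊎ (∀ v → 1 ≤ toℕ (f v))
  ⊎ (∃₂ λ u w → u ≢ w × 1 ≤ toℕ (f u) × 1 ≤ toℕ (f w))
IDF-cases {n} {f = f} idf with all? (λ v → 1 ≤? toℕ (f v))
... | yes positive = inj₂ (inj₁ positive)
... | no ¬positive with ¬∀⟶∃¬ n _ (λ v → 1 ≤? toℕ (f v)) ¬positive
...   | x , fx≱1 with idf x (n<1⇒n≡0 (≰⇒> fx≱1))
...     | inj₁ (u , w , u≢w , _ , _ , fu≡1 , fw≡1) =
          inj₂ (inj₂ (u , w , u≢w , ≤-reflexive (sym fu≡1) , ≤-reflexive (sym fw≡1)))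
...     | inj₂ (w , _ , fw≡2) = inj₁ (w , fw≡2)

2≤weight : ∀ {n} {D : Digraph n} → 2 ≤ n → (f : Labeling n) → IsIDF D f → 2 ≤ weight f
2≤weight n≥2 f idf rewrite weight≡∑ f with IDF-cases idf
... | inj₁ (v , fv≡2) = subst (_≤ ∑ (toℕ ∘ f)) fv≡2 (≤∑ (toℕ ∘ f) v)
... | inj₂ (inj₁ positive) = ≤-trans n≥2 (length≤∑ (toℕ ∘ f) positive)
... | inj₂ (inj₂ (u , w , u≢w , fu≥1 , fw≥1)) = ≤-trans (+-mono-≤ fu≥1 fw≥1) (+≤∑ (toℕ ∘ f) u≢w)

γI-K* : ∀ n → 2 ≤ n → IsItalianDominationNumber (K* n) 2
γI-K* (suc n) n≥2 = (twoAt zero , twoAt-IDF zero (λ _ → ≢-sym) , weight-twoAt {suc n} zero) , 2≤weight n≥2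

-- Were every vertex in xs, choosing a position where it occurs would inject Fin n into Fin (length xs).
∃∉ : ∀ {n} (xs : List (Fin n)) → length xs < n → ∃ λ v → v ∉ xs
∃∉ {n} xs |xs|<n with all? (λ v → any? (v ≟_) xs)
... | no ¬all = ¬∀⟶∃¬ n _ (λ v → any? (v ≟_) xs) ¬all
... | yes all∈ with pigeonhole |xs|<n (λ v → index (all∈ v))
...   | i , j , i<j , same-index = contradiction i≡j (<⇒≢ i<j)
  where
  i≡j : i ≡ j
  i≡j = trans (lookup-index (all∈ i)) (trans (cong (lookup xs) same-index) (sym (lookup-index (all∈ j))))

increases⇒n≤length : ∀ n → 2 ≤ n → (S : List (Fin n × Fin n)) →
  GammaIIncreases (K* n) (removeArcs (K* n) S) → n ≤ length S
increases⇒n≤length n n≥2 S (k , ((f , idf , weight-f≡k) , _) , increases) with n ≤? length S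
... | yes n≤|S| = n≤|S|
... | no n≰|S| with ∃∉ (map proj₁ S) (subst (_< n) (sym (length-map proj₁ S)) (≰⇒> n≰|S|))
...   | v , v∉tails = contradiction (subst (2 ≤_) weight-f≡k (2≤weight n≥2 f idf)) (<⇒≱ k<2)
  where
  k<2 : k < 2
  k<2 = subst (k <_) (weight-twoAt v)
    (increases (twoAt v) (twoAt-IDF v (λ x x≢v → ≢-sym x≢v , v∉tails ∘ ∈-map⁺ proj₁)))

module _ {n} {D : Digraph n} (σ : Fin n → Fin n)
         (σ-irrefl : ∀ u → u ≢ σ u) (σ²-irrefl : ∀ u → u ≢ σ (σ u))
         (σ-missing : ∀ u → ¬ D u (σ u))
         {f : Labeling n} (idf : IsIDF D f) where

  private
    g : Fin n → ℕ
    g = toℕ ∘ f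

    dominator≢ : ∀ {u w} → D w (σ u) → w ≢ u
    dominator≢ {u} d refl = σ-missing u d

    two+positive : ∀ {i j} → i ≢ j → g i ≡ 2 → 1 ≤ g j → 3 ≤ ∑ g
    two+positive {j = j} i≢j gi≡2 gj≥1 =
      ≤-trans (subst (λ a → 3 ≤ a + g j) (sym gi≡2) (+-monoʳ-≤ 2 gj≥1)) (+≤∑ g i≢j)

    three-positive : ∀ {i j k} → i ≢ j → i ≢ k → j ≢ k → 1 ≤ g i → 1 ≤ g j → 1 ≤ g k → 3 ≤ ∑ g
    three-positive i≢j i≢k j≢k gi≥1 gj≥1 gk≥1 =
      ≤-trans (+-mono-≤ (+-mono-≤ gi≥1 gj≥1) gk≥1) (++≤∑ g i≢j i≢k j≢k)

    positive-σ : ∀ u → 1 ≤ g u → 3 ≤ ∑ g ⊎ 1 ≤ g (σ u)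
    positive-σ u gu≥1 with g (σ u) ≟ℕ 0
    ... | no gσu≢0 = inj₂ (n≢0⇒n>0 gσu≢0)
    ... | yes gσu≡0 with idf (σ u) gσu≡0
    ...   | inj₁ (a , b , a≢b , da , db , ga≡1 , gb≡1) =
            inj₁ (three-positive (≢-sym (dominator≢ da)) (≢-sym (dominator≢ db)) a≢b
                    gu≥1 (≤-reflexive (sym ga≡1)) (≤-reflexive (sym gb≡1)))
    ...   | inj₂ (w , dw , gw≡2) = inj₁ (two+positive (dominator≢ dw) gw≡2 gu≥1)

    two⇒3≤∑ : ∀ v → g v ≡ 2 → 3 ≤ ∑ g
    two⇒3≤∑ v gv≡2 with positive-σ v (≤-trans (s≤s z≤n) (≤-reflexive (sym gv≡2)))
    ... | inj₁ done = done
    ... | inj₂ gσv≥1 = two+positive (σ-irrefl v) gv≡2 gσv≥1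

    two-positive⇒3≤∑ : ∀ {u w} → u ≢ w → 1 ≤ g u → 1 ≤ g w → 3 ≤ ∑ g
    two-positive⇒3≤∑ {u} {w} u≢w gu≥1 gw≥1 with positive-σ u gu≥1
    ... | inj₁ done = done
    ... | inj₂ gσu≥1 with σ u ≟ w
    ...   | no σu≢w = three-positive u≢w (σ-irrefl u) (σu≢w ∘ sym) gu≥1 gw≥1 gσu≥1
    ...   | yes refl with positive-σ (σ u) gσu≥1
    ...     | inj₁ done = done
    ...     | inj₂ gσσu≥1 = three-positive (σ-irrefl u) (σ²-irrefl u) (σ-irrefl (σ u)) gu≥1 gσu≥1 gσσu≥1

  3≤weight : 3 ≤ n → 3 ≤ weight f
  3≤weight n≥3 rewrite weight≡∑ f with IDF-cases idf
  ... | inj₁ (v , gv≡2) = two⇒3≤∑ v gv≡2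
  ... | inj₂ (inj₁ positive) = ≤-trans n≥3 (length≤∑ g positive)
  ... | inj₂ (inj₂ (u , w , u≢w , gu≥1 , gw≥1)) = two-positive⇒3≤∑ u≢w gu≥1 gw≥1

next : ∀ {m} → Fin (3 + m) → Fin (3 + m)
next zero = suc zero
next (suc zero) = suc (suc zero)
next (suc (suc _)) = zero

next-irrefl : ∀ {m} (u : Fin (3 + m)) → u ≢ next u
next-irrefl zero ()
next-irrefl (suc zero) ()
next-irrefl (suc (suc _)) ()

next²-irrefl : ∀ {m} (u : Fin (3 + m)) → u ≢ next (next u)
next²-irrefl zero ()
next²-irrefl (suc zero) ()
next²-irrefl (suc (suc _)) ()

nextArcs : ∀ m → List (Fin (3 + m) × Fin (3 + m))
nextArcs m = map (λ u → u , next u) (allFin (3 + m))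

nextArcs-ArcSet : ∀ m → ArcSet (K* (3 + m)) (nextArcs m)
nextArcs-ArcSet m = Unique-map⁺ (cong proj₁) (allFin⁺ (3 + m)) , All-map⁺ (tabulate⁺ next-irrefl)

length-nextArcs : ∀ m → length (nextArcs m) ≡ 3 + m
length-nextArcs m = trans (length-map _ (allFin (3 + m))) (length-tabulate (λ u → u))

∈-nextArcs : ∀ m (u : Fin (3 + m)) → (u , next u) ∈ nextArcs m
∈-nextArcs m u = ∈-map⁺ (λ v → v , next v) (∈-allFin u)

theorem3p3 : (n : ℕ) → 3 ≤ n → IsItalianBondageNumber (K* n) n
theorem3p3 n@(suc (suc (suc m))) n≥3@(s≤s (s≤s (s≤s _))) =
  ( nextArcs m , nextArcs-ArcSet m , length-nextArcs m
  , 2 , γI-K* n n≥2 , λ f idf → 3≤weight next next-irrefl next²-irrefl next-missing idf n≥3 )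
  , λ S _ → increases⇒n≤length n n≥2 S
  where
  n≥2 : 2 ≤ n
  n≥2 = ≤-trans (n≤1+n 2) n≥3
  next-missing : ∀ u → ¬ removeArcs (K* n) (nextArcs m) u (next u)
  next-missing u (_ , u→next-u∉) = u→next-u∉ (∈-nextArcs m u)
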